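{- Let $G$ be a graph with $V(G)=\{v_1,\ldots,v_n\}$ and let $\mathcal{H}=(L,H)$ be a prime cover of $G$ of order $3$, with the vertices of $H$ arbitrarily named so that $L(v)\subseteq\{(v,j):j\in\mathbb{F}_3\}$ for each $v\in V(G)$. Let $$f(x_1,\ldots,x_n)=\prod_{v_iv_j\in E(G),\, j>i}\big(x_i+B(\sigma_{v_iv_j})\,x_j\big)\in\mathbb{F}_3[x_1,\ldots,x_n].$$ If $t_1,\ldots,t_n$ are nonnegative integers such that the coefficient of $\prod_{i=1}^n x_i^{t_i}$ in $f$ is nonzero and $|L(v_i)|>t_i$ for each $i\in[n]$, then there is an $\mathcal{H}$-coloring of $G$.
   Context: All graphs are finite and simple. A cover of a graph $G$ is a pair $\mathcal{H}=(L,H)$ where $H$ is a graph and $L:V(G)\to\mathcal{P}(V(H))$ satisfies: (1) $\{L(u)\}$ partitions $V(H)$; (2) each $H[L(u)]$ is complete; (3) if $E_H(L(u),L(v))\neq\emptyset$ then $u=v$ or $uv\in E(G)$; (4) if $uv\in E(G)$ then $E_H(L(u),L(v))$ is a matching (possibly empty). An $\mathcal{H}$-coloring is an independent set of $H$ of size $|V(G)|$. A prime cover of order $3$ is a cover with $|L(v)|\le 3$ for all $v$. With the given naming, for an edge $v_iv_j$, $j>i$, the saturation function $\sigma_{v_iv_j}$ maps each $q\in\mathbb{F}_3$ with $(v_i,q)$ saturated by $E_H(L(v_i),L(v_j))$ to the unique $r$ with $(v_i,q)(v_j,r)\in E(H)$. It is good if $q-\sigma_{v_iv_j}(q)$ is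 the same element of $\mathbb{F}_3$ for all $q$ in its domain (vacuously good if empty), and bad otherwise. $B(\sigma_{v_iv_j})=-1$ if $\sigma_{v_iv_j}$ is good and $B(\sigma_{v_iv_j})=1$ if it is bad. -}

module Defs where

open import Data.Nat as ℕ using (ℕ; zero; suc)
open import Data.Nat.DivMod using (_mod_)
open import Data.Fin as Fin using (Fin; toℕ)
open import Data.Fin.Properties using () renaming (_≟_ to _≟F_)
open import Data.Bool using (Bool; true; false; _∧_; _∨_; not; if_then_else_)
open import Data.List using (List; []; _∷_; map; concatMap; foldr; allFin; length; filter)
open import Data.Bool.ListAction using (and)
open import Data.Vec as Vec using (Vec; tabulate; replicate; zipWith)
open import Data.Vec.Properties using (≡-dec)
open import Data.Product using (_×_; _,_; Σ)
open import Relation.Nullary using (¬_)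
open import Relation.Nullary.Decidable using (⌊_⌋)
open import Relation.Binary.PropositionalEquality using (_≡_; _≢_)

F₃ : Set
F₃ = Fin 3

_+₃_ : F₃ → F₃ → F₃
a +₃ b = (toℕ a ℕ.+ toℕ b) mod 3

_*₃_ : F₃ → F₃ → F₃
a *₃ b = (toℕ a ℕ.* toℕ b) mod 3

-₃_ : F₃ → F₃
-₃ a = (3 ℕ.∸ toℕ a) mod 3

_-₃_ : F₃ → F₃ → F₃
a -₃ b = a +₃ (-₃ b)

one₃ : F₃
one₃ = Fin.suc Fin.zero

minusOne₃ : F₃
minusOne₃ = -₃ one₃

record Graph (n : ℕ) : Set where
  field
    adj     : Fin n → Fin n → Bool
    symm    : ∀ u v → adj u v ≡ adj v u
    irrefl  : ∀ u → adj u u ≡ false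

-- Covers of order 3 with named vertices: every vertex of H is a pair
-- (v , j) with v ∈ V(G), j ∈ F₃, and L(v) ⊆ {(v,j) : j ∈ F₃} is given
-- by its indicator L v : F₃ → Bool.  V(H) = ⋃ L(v), so condition (1)
-- (partition) holds by construction and |L(v)| ≤ 3 (prime of order 3).

Name : ℕ → Set
Name n = Fin n × F₃

record PrimeCover3 {n : ℕ} (G : Graph n) : Set where
  open Graph G
  field
    L        : Fin n → F₃ → Bool
    -- edge relation of H on names; only meaningful on V(H)
    hadj     : Name n → Name n → Bool
    hsymm    : ∀ x y → hadj x y ≡ hadj y x
    hirrefl  : ∀ x → hadj x x ≡ false
    hinV     : ∀ u a v b → hadj (u , a) (v , b) ≡ true → (L u a ≡ true) × (L v b ≡ true)
    complete : ∀ u a b → L u a ≡ true → L u b ≡ true → a ≢ b → hadj (u , a) (u , b) ≡ true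
    cross    : ∀ u a v b → u ≢ v → hadj (u , a) (v , b) ≡ true → adj u v ≡ true
    -- (4) E_H(L(u),L(v)) is a matching for u ≠ v (the other side
    --     follows by symmetry of hadj)
    matching : ∀ u a v b b′ → u ≢ v → hadj (u , a) (v , b) ≡ true →
               hadj (u , a) (v , b′) ≡ true → b ≡ b′

module _ {n : ℕ} {G : Graph n} (𝓗 : PrimeCover3 G) where
  open PrimeCover3 𝓗

  listSize : Fin n → ℕ
  listSize v = length (filter (λ j → L v j Data.Bool.≟ true) (allFin 3))

  record Coloring : Set where
    field
      S       : Name n → Bool
      inV     : ∀ u a → S (u , a) ≡ true → L u a ≡ true
      indep   : ∀ x y → S x ≡ true → S y ≡ true → hadj x y ≡ false
      size    : foldr ℕ._+_ 0
                  (map (λ u → length (filter (λ j → S (u , j) Data.Bool.≟ true) (allFin 3)))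
                       (allFin n))
                ≡ n

  -- σ_{v_i v_j} (i < j) is good iff q - σ(q) is constant on its domain;
  -- σ(q) = r iff (v_i,q)(v_j,r) ∈ E(H).
  isGood : Fin n → Fin n → Bool
  isGood i j =
    and (concatMap (λ q → concatMap (λ q′ → concatMap (λ r → map (λ r′ →
           not (hadj (i , q) (j , r) ∧ hadj (i , q′) (j , r′))
             ∨ ⌊ (q -₃ r) ≟F (q′ -₃ r′) ⌋)
         (allFin 3)) (allFin 3)) (allFin 3)) (allFin 3))

  B : Fin n → Fin n → F₃
  B i j = if isGood i j then minusOne₃ else one₃

-- Polynomials in F₃[x_1,…,x_n], as finite lists of terms (coefficient,
-- exponent vector); the coefficient of a monomial is the sum of the
-- coefficients of all terms with that exponent vector.

Mono : ℕ → Set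
Mono n = Vec ℕ n

Poly : ℕ → Set
Poly n = List (F₃ × Mono n)

var : ∀ {n} → Fin n → Mono n
var i = tabulate (λ k → if ⌊ k ≟F i ⌋ then 1 else 0)

constOne : ∀ {n} → Poly n
constOne = (one₃ , replicate _ 0) ∷ []

_*P_ : ∀ {n} → Poly n → Poly n → Poly n
p *P q = concatMap (λ { (a , m) → map (λ { (b , m′) → (a *₃ b , zipWith ℕ._+_ m m′) }) q }) p

coeff : ∀ {n} → Mono n → Poly n → F₃
coeff t = foldr (λ { (a , m) acc → if ⌊ ≡-dec ℕ._≟_ m t ⌋ then a +₃ acc else acc }) Fin.zero

fPoly : ∀ {n} {G : Graph n} → PrimeCover3 G → Poly n
fPoly {n} {G} 𝓗 =
  foldr _*P_ constOne
    (concatMap (λ i → concatMap (λ j →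
        if (⌊ toℕ i ℕ.<? toℕ j ⌋ ∧ Graph.adj G i j)
          then ((one₃ , var i) ∷ (B 𝓗 i j , var j) ∷ []) ∷ []
          else [])
      (allFin n)) (allFin n))

{-# OPTIONS --safe #-}
-- Coefficient form of the Combinatorial Nullstellensatz.  For each i choose weights w_i : F₃ → F₃ supported
-- on L(v_i) with Σ_x w_i(x) x^k = 0 for k < t_i and = 1 for k = t_i (Lagrange weights on t_i + 1 points of
-- L(v_i)).  For every polynomial P of degree at most Σ t_i, the sum over a ∈ F₃ⁿ of ∏ w_i(a_i) P(a) is the
-- coefficient of x^t in P.  Take P = ∏ (x_i + B(σ_{v_iv_j}) x_j − c_ij): its top homogeneous part is f, so some
-- a with every (v_i , a_i) ∈ L(v_i) has P(a) ≠ 0.  The constant c_ij is the common value of q + B r over the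
-- edges (v_i,q)(v_j,r) of H: if σ is good, q − r is constant; if it is bad, q + r is, because in F₃ a matching
-- whose differences q − r are not constant has constant sums.  So no edge of H joins two chosen vertices.
module Submission where

open import Defs
open import Data.Nat using (ℕ; _<_)
open import Data.Fin using (Fin; zero)
open import Data.Vec using (Vec; lookup)
open import Relation.Binary.PropositionalEquality using (_≢_)

open import Data.Bool as Bool using (Bool; true; false; _∧_; _∨_; not; if_then_else_)
open import Data.Bool.ListAction using (and)
open import Data.Bool.Properties using (T-≡)
open import Data.Empty using (⊥-elim)
open import Data.Fin using (suc; toℕ)
open import Data.Fin.Properties using (all?; any?; toℕ-injective) renaming (_≟_ to _≟F_)
open import Data.List using (List; []; _∷_; _++_; map; concatMap; foldr; allFin; length; filter)
open import Data.List.Properties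
  using (filter-++; filter-≐; filter-accept; filter-reject; length-tabulate; map-concatMap; concatMap-cong)
open import Data.List.Relation.Unary.All using (All; []; _∷_)
import Data.List.Relation.Unary.All.Properties as All
open import Data.Nat using (suc; _+_; _≤_; z≤n)
import Data.Nat as ℕ
import Data.Nat.Properties as ℕ
open import Data.Product using (Σ; ∃; _×_; _,_; proj₁; proj₂)
open import Data.Vec using ([]; _∷_; zipWith; replicate; tabulate)
import Data.Vec as Vec
open import Data.Vec.Properties using (≡-dec; tabulate-cong)
open import Algebra.Properties.CommutativeSemigroup ℕ.+-commutativeSemigroup using () renaming (interchange to +-interchange)
open import Function using (id; _∘_; Equivalence)
open import Relation.Nullary using (¬_; Dec; yes; no)
open import Relation.Nullary.Decidable
  using (True; toWitness; fromWitness; ⌊_⌋; decidable-stable; _×-dec_; _→-dec_; ¬?; map′)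
open import Relation.Binary.Definitions using (tri<; tri≈; tri>)
open import Relation.Binary.PropositionalEquality using (_≡_; refl; sym; trans; cong; cong₂; subst; subst₂; module ≡-Reasoning)

-- Identities in F₃ are checked by evaluation at all arguments.
decide₁ : {P : F₃ → Set} (P? : ∀ x → Dec (P x)) → {True (all? P?)} → ∀ x → P x
decide₁ P? {p} = toWitness p

decide₂ : {P : F₃ → F₃ → Set} (P? : ∀ x y → Dec (P x y)) →
          {True (all? λ x → all? (P? x))} → ∀ x y → P x y
decide₂ P? {p} = toWitness p

decide₃ : {P : F₃ → F₃ → F₃ → Set} (P? : ∀ x y z → Dec (P x y z)) →
          {True (all? λ x → all? λ y → all? (P? x y))} → ∀ x y z → P x y z
decide₃ P? {p} = toWitness p

decide₄ : {P : F₃ → F₃ → F₃ → F₃ → Set} (P? : ∀ x y z u → Dec (P x y z u)) →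
          {True (all? λ x → all? λ y → all? λ z → all? (P? x y z))} → ∀ x y z u → P x y z u
decide₄ P? {p} = toWitness p

+₃-assoc : ∀ x y z → (x +₃ y) +₃ z ≡ x +₃ (y +₃ z)
+₃-assoc = decide₃ λ x y z → (x +₃ y) +₃ z ≟F x +₃ (y +₃ z)

+₃-identityˡ : ∀ x → zero +₃ x ≡ x
+₃-identityˡ = decide₁ λ x → zero +₃ x ≟F x

+₃-interchange : ∀ x y z u → (x +₃ y) +₃ (z +₃ u) ≡ (x +₃ z) +₃ (y +₃ u)
+₃-interchange = decide₄ λ x y z u → (x +₃ y) +₃ (z +₃ u) ≟F (x +₃ z) +₃ (y +₃ u)

*₃-assoc : ∀ x y z → (x *₃ y) *₃ z ≡ x *₃ (y *₃ z)
*₃-assoc = decide₃ λ x y z → (x *₃ y) *₃ z ≟F x *₃ (y *₃ z)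

*₃-identityˡ : ∀ x → one₃ *₃ x ≡ x
*₃-identityˡ = decide₁ λ x → one₃ *₃ x ≟F x

*₃-identityʳ : ∀ x → x *₃ one₃ ≡ x
*₃-identityʳ = decide₁ λ x → x *₃ one₃ ≟F x

*₃-zeroˡ : ∀ x → zero *₃ x ≡ zero
*₃-zeroˡ = decide₁ λ x → zero *₃ x ≟F zero

*₃-zeroʳ : ∀ x → x *₃ zero ≡ zero
*₃-zeroʳ = decide₁ λ x → x *₃ zero ≟F zero

*₃-distribˡ : ∀ x y z → x *₃ (y +₃ z) ≡ (x *₃ y) +₃ (x *₃ z)
*₃-distribˡ = decide₃ λ x y z → x *₃ (y +₃ z) ≟F (x *₃ y) +₃ (x *₃ z)

*₃-distribʳ : ∀ x y z → (x +₃ y) *₃ z ≡ (x *₃ z) +₃ (y *₃ z)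
*₃-distribʳ = decide₃ λ x y z → (x +₃ y) *₃ z ≟F (x *₃ z) +₃ (y *₃ z)

*₃-interchange : ∀ x y z u → (x *₃ y) *₃ (z *₃ u) ≡ (x *₃ z) *₃ (y *₃ u)
*₃-interchange = decide₄ λ x y z u → (x *₃ y) *₃ (z *₃ u) ≟F (x *₃ z) *₃ (y *₃ u)

*₃-nonzero : ∀ x y → x *₃ y ≢ zero → x ≢ zero × y ≢ zero
*₃-nonzero = decide₂ λ x y → ¬? (x *₃ y ≟F zero) →-dec ¬? (x ≟F zero) ×-dec ¬? (y ≟F zero)

true≢false : true ≢ false
true≢false ()

and-true : ∀ {bs} → and bs ≡ true → All (_≡ true) bs
and-true {[]} _ = []
and-true {true ∷ bs} e = refl ∷ and-true e

all-true : ∀ {bs} → All (_≡ true) bs → and bs ≡ true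
all-true [] = refl
all-true (refl ∷ bs) = all-true bs

module _ {n : ℕ} {A : Set} {P : A → Set} where

  All-map-allFin⁻ : ∀ (f : Fin n → A) → All P (map f (allFin n)) → ∀ i → P (f i)
  All-map-allFin⁻ f = All.tabulate⁻ ∘ All.map⁻

  All-map-allFin⁺ : ∀ (f : Fin n → A) → (∀ i → P (f i)) → All P (map f (allFin n))
  All-map-allFin⁺ f = All.map⁺ ∘ All.tabulate⁺

  All-concatMap-allFin⁻ : ∀ (f : Fin n → List A) → All P (concatMap f (allFin n)) → ∀ i → All P (f i)
  All-concatMap-allFin⁻ f = All.tabulate⁻ ∘ All.map⁻ ∘ All.concat⁻

  All-concatMap-allFin⁺ : ∀ (f : Fin n → List A) → (∀ i → All P (f i)) → All P (concatMap f (allFin n))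
  All-concatMap-allFin⁺ f = All.concat⁺ ∘ All.map⁺ ∘ All.tabulate⁺

implication-true : ∀ {A : Set} {a b} (d : Dec A) → not (a ∧ b) ∨ ⌊ d ⌋ ≡ true → a ≡ true → b ≡ true → A
implication-true (yes p) _ _ _ = p
implication-true {a = true} {true} (no _) ()

true-implication : ∀ {A : Set} a b (d : Dec A) → (a ≡ true → b ≡ true → A) → not (a ∧ b) ∨ ⌊ d ⌋ ≡ true
true-implication false b d _ = refl
true-implication true false d _ = refl
true-implication true true (yes _) _ = refl
true-implication true true (no ¬p) a→b→p = ⊥-elim (¬p (a→b→p refl refl))

map-if : ∀ {A B : Set} (f : A → B) b (x : A) → map f (if b then x ∷ [] else []) ≡ (if b then f x ∷ [] else [])
map-if f true x = refl
map-if f false x = refl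

All-if : ∀ {A : Set} {P : A → Set} {b x} → All P (if b then x ∷ [] else []) → b ≡ true → P x
All-if (px ∷ []) refl = px

Σ₃ : (F₃ → F₃) → F₃
Σ₃ g = g zero +₃ (g (suc zero) +₃ g (suc (suc zero)))

Σ₃-cong : ∀ {g h : F₃ → F₃} → (∀ x → g x ≡ h x) → Σ₃ g ≡ Σ₃ h
Σ₃-cong g≗h = cong₂ _+₃_ (g≗h zero) (cong₂ _+₃_ (g≗h (suc zero)) (g≗h (suc (suc zero))))

Σ₃-*ˡ : ∀ c g → Σ₃ (λ x → c *₃ g x) ≡ c *₃ Σ₃ g
Σ₃-*ˡ c g = sym (trans (*₃-distribˡ c (g zero) _)
                       (cong ((c *₃ g zero) +₃_) (*₃-distribˡ c (g (suc zero)) (g (suc (suc zero))))))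

Σ₃-*ʳ : ∀ c g → Σ₃ (λ x → g x *₃ c) ≡ Σ₃ g *₃ c
Σ₃-*ʳ c g = sym (trans (*₃-distribʳ (g zero) _ c)
                       (cong ((g zero *₃ c) +₃_) (*₃-distribʳ (g (suc zero)) (g (suc (suc zero))) c)))

Σ₃-+ : ∀ g h → Σ₃ (λ x → g x +₃ h x) ≡ Σ₃ g +₃ Σ₃ h
Σ₃-+ g h = trans (cong ((g zero +₃ h zero) +₃_) (+₃-interchange (g 1F) (h 1F) (g 2F) (h 2F)))
                  (+₃-interchange (g zero) (h zero) (g 1F +₃ g 2F) (h 1F +₃ h 2F))
  where
  1F 2F : F₃
  1F = suc zero
  2F = suc (suc zero)

Σ₃-nonzero : ∀ g → Σ₃ g ≢ zero → ∃ λ x → g x ≢ zero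
Σ₃-nonzero g Σg≢0 with any? (λ x → ¬? (g x ≟F zero))
... | yes witness = witness
... | no none = ⊥-elim (Σg≢0 (Σ₃-cong {h = λ _ → zero} vanishes))
  where
  vanishes : ∀ x → g x ≡ zero
  vanishes x = decidable-stable (g x ≟F zero) (λ gx≢0 → none (x , gx≢0))

Σⁿ : ∀ n → (Vec F₃ n → F₃) → F₃
Σⁿ ℕ.zero g = g []
Σⁿ (suc n) g = Σ₃ λ x → Σⁿ n (λ a → g (x ∷ a))

Σⁿ-cong : ∀ n {g h : Vec F₃ n → F₃} → (∀ a → g a ≡ h a) → Σⁿ n g ≡ Σⁿ n h
Σⁿ-cong ℕ.zero g≗h = g≗h []
Σⁿ-cong (suc n) g≗h = Σ₃-cong λ x → Σⁿ-cong n (λ a → g≗h (x ∷ a))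

Σⁿ-*ˡ : ∀ n c g → Σⁿ n (λ a → c *₃ g a) ≡ c *₃ Σⁿ n g
Σⁿ-*ˡ ℕ.zero c g = refl
Σⁿ-*ˡ (suc n) c g = trans (Σ₃-cong λ x → Σⁿ-*ˡ n c (λ a → g (x ∷ a)))
                          (Σ₃-*ˡ c λ x → Σⁿ n (λ a → g (x ∷ a)))

Σⁿ-+ : ∀ n g h → Σⁿ n (λ a → g a +₃ h a) ≡ Σⁿ n g +₃ Σⁿ n h
Σⁿ-+ ℕ.zero g h = refl
Σⁿ-+ (suc n) g h = trans (Σ₃-cong λ x → Σⁿ-+ n (λ a → g (x ∷ a)) (λ a → h (x ∷ a)))
                         (Σ₃-+ (λ x → Σⁿ n (λ a → g (x ∷ a))) (λ x → Σⁿ n (λ a → h (x ∷ a))))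

Σⁿ-zero : ∀ n → Σⁿ n (λ _ → zero) ≡ zero
Σⁿ-zero ℕ.zero = refl
Σⁿ-zero (suc n) = Σ₃-cong {h = λ _ → zero} λ _ → Σⁿ-zero n

Σⁿ-nonzero : ∀ n g → Σⁿ n g ≢ zero → ∃ λ a → g a ≢ zero
Σⁿ-nonzero ℕ.zero g g≢0 = [] , g≢0
Σⁿ-nonzero (suc n) g Σg≢0 =
  let x , Σx≢0 = Σ₃-nonzero (λ x → Σⁿ n (λ a → g (x ∷ a))) Σg≢0
      a , gxa≢0 = Σⁿ-nonzero n (λ a → g (x ∷ a)) Σx≢0
  in x ∷ a , gxa≢0

_^₃_ : F₃ → ℕ → F₃
x ^₃ ℕ.zero = one₃
x ^₃ suc k = x *₃ (x ^₃ k)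

^₃-+ : ∀ x k l → x ^₃ (k + l) ≡ (x ^₃ k) *₃ (x ^₃ l)
^₃-+ x ℕ.zero l = sym (*₃-identityˡ (x ^₃ l))
^₃-+ x (suc k) l = trans (cong (x *₃_) (^₃-+ x k l)) (sym (*₃-assoc x (x ^₃ k) (x ^₃ l)))

evalMono : ∀ {n} → Mono n → Vec F₃ n → F₃
evalMono [] [] = one₃
evalMono (k ∷ m) (x ∷ a) = (x ^₃ k) *₃ evalMono m a

eval : ∀ {n} → Poly n → Vec F₃ n → F₃
eval [] a = zero
eval ((c , m) ∷ p) a = (c *₃ evalMono m a) +₃ eval p a

-- ((c , m) ∷ p) *P q reduces to termMul (c , m) q ++ p *P q.
termMul : ∀ {n} → F₃ × Mono n → Poly n → Poly n
termMul (c , m) = map λ bm → (c *₃ proj₁ bm , zipWith _+_ m (proj₂ bm))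

∏ : ∀ {n} → List (Poly n) → Poly n
∏ = foldr _*P_ constOne

evalMono-zipWith : ∀ {n} (m m′ : Mono n) a → evalMono (zipWith _+_ m m′) a ≡ evalMono m a *₃ evalMono m′ a
evalMono-zipWith [] [] [] = refl
evalMono-zipWith (k ∷ m) (l ∷ m′) (x ∷ a) =
  trans (cong₂ _*₃_ (^₃-+ x k l) (evalMono-zipWith m m′ a))
        (*₃-interchange (x ^₃ k) (x ^₃ l) (evalMono m a) (evalMono m′ a))

eval-++ : ∀ {n} (p q : Poly n) a → eval (p ++ q) a ≡ eval p a +₃ eval q a
eval-++ [] q a = sym (+₃-identityˡ (eval q a))
eval-++ ((c , m) ∷ p) q a =
  trans (cong ((c *₃ evalMono m a) +₃_) (eval-++ p q a)) (sym (+₃-assoc (c *₃ evalMono m a) (eval p a) (eval q a)))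

eval-termMul : ∀ {n} c (m : Mono n) q a → eval (termMul (c , m) q) a ≡ (c *₃ evalMono m a) *₃ eval q a
eval-termMul c m [] a = sym (*₃-zeroʳ (c *₃ evalMono m a))
eval-termMul c m ((b , m′) ∷ q) a = begin
  ((c *₃ b) *₃ evalMono (zipWith _+_ m m′) a) +₃ eval (termMul (c , m) q) a
    ≡⟨ cong₂ _+₃_ (cong ((c *₃ b) *₃_) (evalMono-zipWith m m′ a)) (eval-termMul c m q a) ⟩
  ((c *₃ b) *₃ (evalMono m a *₃ evalMono m′ a)) +₃ ((c *₃ evalMono m a) *₃ eval q a)
    ≡⟨ cong (_+₃ ((c *₃ evalMono m a) *₃ eval q a)) (*₃-interchange c b (evalMono m a) (evalMono m′ a)) ⟩
  ((c *₃ evalMono m a) *₃ (b *₃ evalMono m′ a)) +₃ ((c *₃ evalMono m a) *₃ eval q a)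
    ≡⟨ sym (*₃-distribˡ (c *₃ evalMono m a) (b *₃ evalMono m′ a) (eval q a)) ⟩
  (c *₃ evalMono m a) *₃ eval ((b , m′) ∷ q) a ∎
  where open ≡-Reasoning

eval-*P : ∀ {n} (p q : Poly n) a → eval (p *P q) a ≡ eval p a *₃ eval q a
eval-*P [] q a = sym (*₃-zeroˡ (eval q a))
eval-*P ((c , m) ∷ p) q a =
  trans (eval-++ (termMul (c , m) q) (p *P q) a)
        (trans (cong₂ _+₃_ (eval-termMul c m q a) (eval-*P p q a))
               (sym (*₃-distribʳ (c *₃ evalMono m a) (eval p a) (eval q a))))

eval-∏-nonzero : ∀ {n} (fs : List (Poly n)) a → eval (∏ fs) a ≢ zero → All (λ f → eval f a ≢ zero) fs
eval-∏-nonzero [] a _ = []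
eval-∏-nonzero (f ∷ fs) a ∏≢0 =
  let f≢0 , rest≢0 = *₃-nonzero (eval f a) (eval (∏ fs) a) (λ ≡0 → ∏≢0 (trans (eval-*P f (∏ fs) a) ≡0))
  in f≢0 ∷ eval-∏-nonzero fs a rest≢0

deg : ∀ {n} → Mono n → ℕ
deg = Vec.sum

deg-zipWith : ∀ {n} (m m′ : Mono n) → deg (zipWith _+_ m m′) ≡ deg m + deg m′
deg-zipWith [] [] = refl
deg-zipWith (k ∷ m) (l ∷ m′) = trans (cong ((k + l) +_) (deg-zipWith m m′)) (+-interchange k l (deg m) (deg m′))

deg-replicate-0 : ∀ n → deg (replicate n 0) ≡ 0
deg-replicate-0 ℕ.zero = refl
deg-replicate-0 (suc n) = deg-replicate-0 n

evalMono-replicate-0 : ∀ {n} (a : Vec F₃ n) → evalMono (replicate n 0) a ≡ one₃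
evalMono-replicate-0 [] = refl
evalMono-replicate-0 (x ∷ a) = trans (*₃-identityˡ (evalMono (replicate _ 0) a)) (evalMono-replicate-0 a)

var-zero : ∀ {n} → var {suc n} zero ≡ 1 ∷ replicate n 0
var-zero = cong (1 ∷_) (zeros _)
  where
  zeros : ∀ n → tabulate {n = n} (λ _ → 0) ≡ replicate n 0
  zeros ℕ.zero = refl
  zeros (suc n) = cong (0 ∷_) (zeros n)

var-suc : ∀ {n} (i : Fin n) → var (suc i) ≡ 0 ∷ var i
var-suc i = cong (0 ∷_) (tabulate-cong indicator)
  where
  indicator : ∀ k → (if ⌊ suc k ≟F suc i ⌋ then 1 else 0) ≡ (if ⌊ k ≟F i ⌋ then 1 else 0)
  indicator k with k ≟F i
  ... | yes refl = refl
  ... | no _ = refl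

deg-var : ∀ {n} (i : Fin n) → deg (var i) ≡ 1
deg-var {suc n} zero = trans (cong deg (var-zero {n})) (cong suc (deg-replicate-0 n))
deg-var (suc i) = trans (cong deg (var-suc i)) (deg-var i)

evalMono-var : ∀ {n} (i : Fin n) a → evalMono (var i) a ≡ lookup a i
evalMono-var zero (x ∷ a) =
  trans (cong (λ m → evalMono m (x ∷ a)) var-zero)
        (trans (cong ((x *₃ one₃) *₃_) (evalMono-replicate-0 a)) (trans (*₃-identityʳ (x *₃ one₃)) (*₃-identityʳ x)))
evalMono-var (suc i) (x ∷ a) =
  trans (cong (λ m → evalMono m (x ∷ a)) (var-suc i)) (trans (*₃-identityˡ (evalMono (var i) a)) (evalMono-var i a))

-- Homogeneous parts

AtMost : ∀ {n} → ℕ → Poly n → Set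
AtMost D = All λ cm → deg (proj₂ cm) ≤ D

Homogeneous : ∀ {n} → ℕ → Poly n → Set
Homogeneous D = All λ cm → deg (proj₂ cm) ≡ D

hasDegree? : ∀ {n} (D : ℕ) (cm : F₃ × Mono n) → Dec (deg (proj₂ cm) ≡ D)
hasDegree? D cm = deg (proj₂ cm) ℕ.≟ D

part : ∀ {n} → ℕ → Poly n → Poly n
part D = filter (hasDegree? D)

part-accept : ∀ {n D} c (m : Mono n) p → deg m ≡ D → part D ((c , m) ∷ p) ≡ (c , m) ∷ part D p
part-accept {D = D} c m p = filter-accept (hasDegree? D) {c , m} {p}

part-reject : ∀ {n D} c (m : Mono n) p → deg m ≢ D → part D ((c , m) ∷ p) ≡ part D p
part-reject {D = D} c m p = filter-reject (hasDegree? D) {c , m} {p}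

coeff-part : ∀ {n} (t : Mono n) p → coeff t p ≡ coeff t (part (deg t) p)
coeff-part t [] = refl
coeff-part t ((c , m) ∷ p) with deg m ℕ.≟ deg t
... | yes degm≡degt = begin
  coeff t ((c , m) ∷ p)
    ≡⟨ cong (λ z → if ⌊ ≡-dec ℕ._≟_ m t ⌋ then c +₃ z else z) (coeff-part t p) ⟩
  coeff t ((c , m) ∷ part (deg t) p)
    ≡⟨ cong (coeff t) (sym (part-accept c m p degm≡degt)) ⟩
  coeff t (part (deg t) ((c , m) ∷ p)) ∎
  where open ≡-Reasoning
... | no degm≢degt = begin
  coeff t ((c , m) ∷ p)        ≡⟨ skip (≡-dec ℕ._≟_ m t) ⟩
  coeff t p                    ≡⟨ coeff-part t p ⟩
  coeff t (part (deg t) p)     ≡⟨ cong (coeff t) (sym (part-reject c m p degm≢degt)) ⟩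
  coeff t (part (deg t) ((c , m) ∷ p)) ∎
  where
  open ≡-Reasoning
  skip : (d : Dec (m ≡ t)) → (if ⌊ d ⌋ then c +₃ coeff t p else coeff t p) ≡ coeff t p
  skip (yes refl) = ⊥-elim (degm≢degt refl)
  skip (no _) = refl

coeff-homogeneous : ∀ {n D} (t : Mono n) {p} → Homogeneous D p → deg t ≢ D → coeff t p ≡ zero
coeff-homogeneous t [] _ = refl
coeff-homogeneous t {(c , m) ∷ p} (degm≡D ∷ hom) degt≢D with ≡-dec ℕ._≟_ m t
... | yes refl = ⊥-elim (degt≢D degm≡D)
... | no _ = coeff-homogeneous t hom degt≢D

AtMost-termMul : ∀ {n a b} c (m : Mono n) {q} → deg m ≤ a → AtMost b q → AtMost (a + b) (termMul (c , m) q)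
AtMost-termMul c m degm≤a [] = []
AtMost-termMul {a = a} {b} c m {(_ , m′) ∷ _} degm≤a (degm′≤b ∷ q≤) =
  subst (_≤ a + b) (sym (deg-zipWith m m′)) (ℕ.+-mono-≤ degm≤a degm′≤b) ∷ AtMost-termMul c m degm≤a q≤

AtMost-*P : ∀ {n a b} {p q : Poly n} → AtMost a p → AtMost b q → AtMost (a + b) (p *P q)
AtMost-*P [] q≤ = []
AtMost-*P {p = (c , m) ∷ _} (degm≤a ∷ p≤) q≤ = All.++⁺ (AtMost-termMul c m degm≤a q≤) (AtMost-*P p≤ q≤)

Homogeneous-termMul : ∀ {n a b} c (m : Mono n) {q} → deg m ≡ a → Homogeneous b q → Homogeneous (a + b) (termMul (c , m) q)
Homogeneous-termMul c m degm≡a [] = []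
Homogeneous-termMul c m {(_ , m′) ∷ _} degm≡a (degm′≡b ∷ q≡) =
  trans (deg-zipWith m m′) (cong₂ _+_ degm≡a degm′≡b) ∷ Homogeneous-termMul c m degm≡a q≡

Homogeneous-*P : ∀ {n a b} {p q : Poly n} → Homogeneous a p → Homogeneous b q → Homogeneous (a + b) (p *P q)
Homogeneous-*P [] q≡ = []
Homogeneous-*P {p = (c , m) ∷ _} (degm≡a ∷ p≡) q≡ =
  All.++⁺ (Homogeneous-termMul c m degm≡a q≡) (Homogeneous-*P p≡ q≡)

part-termMul : ∀ {n a b} c (m : Mono n) q → deg m ≡ a → part (a + b) (termMul (c , m) q) ≡ termMul (c , m) (part b q)
part-termMul c m [] _ = refl
part-termMul {a = a} {b} c m ((c′ , m′) ∷ q) degm≡a with deg m′ ℕ.≟ b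
... | yes degm′≡b = begin
  part (a + b) (termMul (c , m) ((c′ , m′) ∷ q))
    ≡⟨ part-accept (c *₃ c′) (zipWith _+_ m m′) (termMul (c , m) q) degree ⟩
  (c *₃ c′ , zipWith _+_ m m′) ∷ part (a + b) (termMul (c , m) q)
    ≡⟨ cong (_ ∷_) (part-termMul c m q degm≡a) ⟩
  termMul (c , m) ((c′ , m′) ∷ part b q)
    ≡⟨ cong (termMul (c , m)) (sym (part-accept c′ m′ q degm′≡b)) ⟩
  termMul (c , m) (part b ((c′ , m′) ∷ q)) ∎
  where
  open ≡-Reasoning
  degree : deg (zipWith _+_ m m′) ≡ a + b
  degree = trans (deg-zipWith m m′) (cong₂ _+_ degm≡a degm′≡b)
... | no degm′≢b = begin
  part (a + b) (termMul (c , m) ((c′ , m′) ∷ q))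
    ≡⟨ part-reject (c *₃ c′) (zipWith _+_ m m′) (termMul (c , m) q) degree ⟩
  part (a + b) (termMul (c , m) q)
    ≡⟨ part-termMul c m q degm≡a ⟩
  termMul (c , m) (part b q)
    ≡⟨ cong (termMul (c , m)) (sym (part-reject c′ m′ q degm′≢b)) ⟩
  termMul (c , m) (part b ((c′ , m′) ∷ q)) ∎
  where
  open ≡-Reasoning
  degree : deg (zipWith _+_ m m′) ≢ a + b
  degree d≡ =
    degm′≢b (ℕ.+-cancelˡ-≡ a (deg m′) b (trans (cong (_+ deg m′) (sym degm≡a)) (trans (sym (deg-zipWith m m′)) d≡)))

part-termMul-lower : ∀ {n a b} c (m : Mono n) {q} → deg m < a → AtMost b q → part (a + b) (termMul (c , m) q) ≡ []
part-termMul-lower c m _ [] = refl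
part-termMul-lower {a = a} {b} c m {(c′ , m′) ∷ q} degm<a (degm′≤b ∷ q≤) =
  trans (part-reject (c *₃ c′) (zipWith _+_ m m′) (termMul (c , m) q) degree) (part-termMul-lower c m degm<a q≤)
  where
  degree : deg (zipWith _+_ m m′) ≢ a + b
  degree = ℕ.<⇒≢ (subst (_< a + b) (sym (deg-zipWith m m′)) (ℕ.+-mono-<-≤ degm<a degm′≤b))

part-*P : ∀ {n a b} {p q : Poly n} → AtMost a p → AtMost b q → part (a + b) (p *P q) ≡ part a p *P part b q
part-*P [] _ = refl
part-*P {a = a} {b} {(c , m) ∷ p} {q} (degm≤a ∷ p≤) q≤ with deg m ℕ.≟ a
... | yes degm≡a = begin
  part (a + b) (termMul (c , m) q ++ (p *P q))
    ≡⟨ filter-++ (hasDegree? (a + b)) (termMul (c , m) q) (p *P q) ⟩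
  part (a + b) (termMul (c , m) q) ++ part (a + b) (p *P q)
    ≡⟨ cong₂ _++_ (part-termMul c m q degm≡a) (part-*P p≤ q≤) ⟩
  ((c , m) ∷ part a p) *P part b q
    ≡⟨ cong (_*P part b q) (sym (part-accept c m p degm≡a)) ⟩
  part a ((c , m) ∷ p) *P part b q ∎
  where open ≡-Reasoning
... | no degm≢a = begin
  part (a + b) (termMul (c , m) q ++ (p *P q))
    ≡⟨ filter-++ (hasDegree? (a + b)) (termMul (c , m) q) (p *P q) ⟩
  part (a + b) (termMul (c , m) q) ++ part (a + b) (p *P q)
    ≡⟨ cong₂ _++_ (part-termMul-lower c m (ℕ.≤∧≢⇒< degm≤a degm≢a) q≤) (part-*P p≤ q≤) ⟩
  part a p *P part b q
    ≡⟨ cong (_*P part b q) (sym (part-reject c m p degm≢a)) ⟩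
  part a ((c , m) ∷ p) *P part b q ∎
  where open ≡-Reasoning

AtMost-∏ : ∀ {n} {A : Set} (φ : A → Poly n) → (∀ e → AtMost 1 (φ e)) → ∀ E → AtMost (length E) (∏ (map φ E))
AtMost-∏ {n} φ φ≤1 [] = ℕ.≤-reflexive (deg-replicate-0 n) ∷ []
AtMost-∏ φ φ≤1 (e ∷ E) = AtMost-*P (φ≤1 e) (AtMost-∏ φ φ≤1 E)

Homogeneous-∏ : ∀ {n} {A : Set} (φ : A → Poly n) → (∀ e → Homogeneous 1 (φ e)) → ∀ E →
                Homogeneous (length E) (∏ (map φ E))
Homogeneous-∏ {n} φ φ≡1 [] = deg-replicate-0 n ∷ []
Homogeneous-∏ φ φ≡1 (e ∷ E) = Homogeneous-*P (φ≡1 e) (Homogeneous-∏ φ φ≡1 E)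

part-∏ : ∀ {n} {A : Set} (φ φ′ : A → Poly n) → (∀ e → AtMost 1 (φ′ e)) → (∀ e → part 1 (φ′ e) ≡ φ e) →
         ∀ E → part (length E) (∏ (map φ′ E)) ≡ ∏ (map φ E)
part-∏ {n} φ φ′ φ′≤1 part≡ [] = part-accept one₃ (replicate n 0) [] (deg-replicate-0 n)
part-∏ φ φ′ φ′≤1 part≡ (e ∷ E) =
  trans (part-*P (φ′≤1 e) (AtMost-∏ φ′ φ′≤1 E)) (cong₂ _*P_ (part≡ e) (part-∏ φ φ′ φ′≤1 part≡ E))

-- The coefficient formula

moment : (F₃ → F₃) → ℕ → F₃
moment w k = Σ₃ λ x → w x *₃ (x ^₃ k)

Dual : (F₃ → F₃) → ℕ → Set
Dual w t = moment w t ≡ one₃ × (∀ {k} → k < t → moment w k ≡ zero)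

weight : ∀ {n} → (Fin n → F₃ → F₃) → Vec F₃ n → F₃
weight ws [] = one₃
weight ws (x ∷ a) = ws zero x *₃ weight (ws ∘ suc) a

momentProduct : ∀ {n} → (Fin n → F₃ → F₃) → Mono n → F₃
momentProduct ws [] = one₃
momentProduct ws (k ∷ m) = moment (ws zero) k *₃ momentProduct (ws ∘ suc) m

Σⁿ-weight-evalMono : ∀ {n} ws (m : Mono n) → Σⁿ n (λ a → weight ws a *₃ evalMono m a) ≡ momentProduct ws m
Σⁿ-weight-evalMono ws [] = refl
Σⁿ-weight-evalMono {suc n} ws (k ∷ m) = begin
  Σ₃ (λ x → Σⁿ n (λ a → (w x *₃ W a) *₃ ((x ^₃ k) *₃ M a)))
    ≡⟨ Σ₃-cong (λ x → Σⁿ-cong n λ a → *₃-interchange (w x) (W a) (x ^₃ k) (M a)) ⟩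
  Σ₃ (λ x → Σⁿ n (λ a → (w x *₃ (x ^₃ k)) *₃ (W a *₃ M a)))
    ≡⟨ Σ₃-cong (λ x → Σⁿ-*ˡ n (w x *₃ (x ^₃ k)) (λ a → W a *₃ M a)) ⟩
  Σ₃ (λ x → (w x *₃ (x ^₃ k)) *₃ Σⁿ n (λ a → W a *₃ M a))
    ≡⟨ Σ₃-cong (λ x → cong ((w x *₃ (x ^₃ k)) *₃_) (Σⁿ-weight-evalMono (ws ∘ suc) m)) ⟩
  Σ₃ (λ x → (w x *₃ (x ^₃ k)) *₃ momentProduct (ws ∘ suc) m)
    ≡⟨ Σ₃-*ʳ (momentProduct (ws ∘ suc) m) (λ x → w x *₃ (x ^₃ k)) ⟩
  moment w k *₃ momentProduct (ws ∘ suc) m ∎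
  where
  open ≡-Reasoning
  w : F₃ → F₃
  w = ws zero
  W M : Vec F₃ n → F₃
  W = weight (ws ∘ suc)
  M = evalMono m

momentProduct-self : ∀ {n} ws (t : Mono n) → (∀ i → Dual (ws i) (lookup t i)) → momentProduct ws t ≡ one₃
momentProduct-self ws [] dual = refl
momentProduct-self ws (s ∷ t) dual = cong₂ _*₃_ (proj₁ (dual zero)) (momentProduct-self (ws ∘ suc) t (dual ∘ suc))

momentProduct-other : ∀ {n} ws (t m : Mono n) → (∀ i → Dual (ws i) (lookup t i)) →
                      deg m ≤ deg t → m ≢ t → momentProduct ws m ≡ zero
momentProduct-other ws [] [] dual _ m≢t = ⊥-elim (m≢t refl)
momentProduct-other ws (s ∷ t) (k ∷ m) dual degm≤ m≢t with k ℕ.<? s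
... | yes k<s =
  trans (cong (_*₃ momentProduct (ws ∘ suc) m) (proj₂ (dual zero) k<s)) (*₃-zeroˡ (momentProduct (ws ∘ suc) m))
... | no k≮s with ≡-dec ℕ._≟_ m t
...   | yes refl = ⊥-elim (m≢t (cong (_∷ m) (ℕ.≤-antisym (ℕ.+-cancelʳ-≤ (deg m) k s degm≤) (ℕ.≮⇒≥ k≮s))))
...   | no tail≢ = trans (cong (moment (ws zero) k *₃_) (momentProduct-other (ws ∘ suc) t m (dual ∘ suc) tail≤ tail≢))
                         (*₃-zeroʳ (moment (ws zero) k))
  where
  tail≤ : deg m ≤ deg t
  tail≤ = ℕ.+-cancelˡ-≤ s (deg m) (deg t) (ℕ.≤-trans (ℕ.+-monoˡ-≤ (deg m) (ℕ.≮⇒≥ k≮s)) degm≤)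

coefficient-formula : ∀ {n} ws (t : Mono n) → (∀ i → Dual (ws i) (lookup t i)) → ∀ p → AtMost (deg t) p →
                      Σⁿ n (λ a → weight ws a *₃ eval p a) ≡ coeff t p
coefficient-formula {n} ws t dual [] [] = trans (Σⁿ-cong n λ a → *₃-zeroʳ (weight ws a)) (Σⁿ-zero n)
coefficient-formula {n} ws t dual ((c , m) ∷ p) (degm≤ ∷ p≤) = begin
  Σⁿ n (λ a → W a *₃ ((c *₃ M a) +₃ eval p a))
    ≡⟨ Σⁿ-cong n (λ a → expand (W a) c (M a) (eval p a)) ⟩
  Σⁿ n (λ a → (c *₃ (W a *₃ M a)) +₃ (W a *₃ eval p a))
    ≡⟨ Σⁿ-+ n (λ a → c *₃ (W a *₃ M a)) (λ a → W a *₃ eval p a) ⟩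
  Σⁿ n (λ a → c *₃ (W a *₃ M a)) +₃ Σⁿ n (λ a → W a *₃ eval p a)
    ≡⟨ cong₂ _+₃_ (trans (Σⁿ-*ˡ n c λ a → W a *₃ M a) (cong (c *₃_) (Σⁿ-weight-evalMono ws m)))
                  (coefficient-formula ws t dual p p≤) ⟩
  (c *₃ momentProduct ws m) +₃ coeff t p
    ≡⟨ contribution (≡-dec ℕ._≟_ m t) ⟩
  coeff t ((c , m) ∷ p) ∎
  where
  open ≡-Reasoning
  W M : Vec F₃ n → F₃
  W = weight ws
  M = evalMono m
  expand : ∀ w c x y → w *₃ ((c *₃ x) +₃ y) ≡ (c *₃ (w *₃ x)) +₃ (w *₃ y)
  expand = decide₄ λ w c x y → w *₃ ((c *₃ x) +₃ y) ≟F (c *₃ (w *₃ x)) +₃ (w *₃ y)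
  contribution : (d : Dec (m ≡ t)) →
                 (c *₃ momentProduct ws m) +₃ coeff t p ≡ (if ⌊ d ⌋ then c +₃ coeff t p else coeff t p)
  contribution (yes refl) = cong (_+₃ coeff t p) (trans (cong (c *₃_) (momentProduct-self ws t dual)) (*₃-identityʳ c))
  contribution (no m≢t) =
    trans (cong (_+₃ coeff t p) (trans (cong (c *₃_) (momentProduct-other ws t m dual degm≤ m≢t)) (*₃-zeroʳ c)))
          (+₃-identityˡ (coeff t p))

weight-nonzero : ∀ {n} ws (a : Vec F₃ n) → weight ws a ≢ zero → ∀ i → ws i (lookup a i) ≢ zero
weight-nonzero ws (x ∷ a) W≢0 zero = proj₁ (*₃-nonzero (ws zero x) (weight (ws ∘ suc) a) W≢0)
weight-nonzero ws (x ∷ a) W≢0 (suc i) =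
  weight-nonzero (ws ∘ suc) a (proj₂ (*₃-nonzero (ws zero x) (weight (ws ∘ suc) a) W≢0)) i

-- Lagrange weights

Supported : (F₃ → Bool) → (F₃ → F₃) → Set
Supported L w = ∀ x → w x ≢ zero → L x ≡ true

size : (F₃ → Bool) → ℕ
size L = length (filter (λ j → L j Bool.≟ true) (allFin 3))

tri : {A : Set} → A → A → A → F₃ → A
tri x₀ x₁ x₂ zero = x₀
tri x₀ x₁ x₂ (suc zero) = x₁
tri x₀ x₁ x₂ (suc (suc zero)) = x₂

tri-η : ∀ {A : Set} (f : F₃ → A) x → tri (f zero) (f (suc zero)) (f (suc (suc zero))) x ≡ f x
tri-η f zero = refl
tri-η f (suc zero) = refl
tri-η f (suc (suc zero)) = refl

-- The weight of x is 1 / ∏ (x − y) over the other points y of the set P of the first t + 1 points of L,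
-- and 0 off P (the last clause covers t = 2, where P = F₃, and junk cases with t ≥ |L|).
lagrange : Bool → Bool → Bool → ℕ → F₃ → F₃
lagrange true  _     _ 0 = tri one₃ zero zero
lagrange false true  _ 0 = tri zero one₃ zero
lagrange false false _ 0 = tri zero zero one₃
lagrange true  true  _ 1 = tri minusOne₃ one₃ zero
lagrange true  false _ 1 = tri one₃ zero minusOne₃
lagrange false _     _ 1 = tri zero minusOne₃ one₃
lagrange _     _     _ _ = tri minusOne₃ minusOne₃ minusOne₃

all?ᴮ : {P : Bool → Set} → (∀ b → Dec (P b)) → Dec (∀ b → P b)
all?ᴮ P? = map′ (λ (p₀ , p₁) → λ { false → p₀ ; true → p₁ }) (λ p → p false , p true) (P? false ×-dec P? true)

lagrange-weights : ∀ b₀ b₁ b₂ {t} → t < size (tri b₀ b₁ b₂) →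
                   Supported (tri b₀ b₁ b₂) (lagrange b₀ b₁ b₂ t) × Dual (lagrange b₀ b₁ b₂ t) t
lagrange-weights =
  toWitness {a? = all?ᴮ λ b₀ → all?ᴮ λ b₁ → all?ᴮ λ b₂ → ℕ.allUpTo? (weights? b₀ b₁ b₂) (size (tri b₀ b₁ b₂))} _
  where
  weights? : ∀ b₀ b₁ b₂ t →
             Dec (Supported (tri b₀ b₁ b₂) (lagrange b₀ b₁ b₂ t) × Dual (lagrange b₀ b₁ b₂ t) t)
  weights? b₀ b₁ b₂ t =
    (all? λ x → ¬? (w x ≟F zero) →-dec (tri b₀ b₁ b₂ x Bool.≟ true))
      ×-dec (moment w t ≟F one₃) ×-dec ℕ.allUpTo? (λ k → moment w k ≟F zero) t
    where
    w : F₃ → F₃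
    w = lagrange b₀ b₁ b₂ t

size-tri : ∀ L → size L ≡ size (tri (L zero) (L (suc zero)) (L (suc (suc zero))))
size-tri L = cong length (filter-≐ (λ j → L j Bool.≟ true) (λ j → L′ j Bool.≟ true) (L⊆L′ , L′⊆L) (allFin 3))
  where
  L′ : F₃ → Bool
  L′ = tri (L zero) (L (suc zero)) (L (suc (suc zero)))
  L⊆L′ : ∀ {x} → L x ≡ true → L′ x ≡ true
  L⊆L′ {x} = trans (tri-η L x)
  L′⊆L : ∀ {x} → L′ x ≡ true → L x ≡ true
  L′⊆L {x} = trans (sym (tri-η L x))

weights : ∀ L {t} → t < size L → Σ (F₃ → F₃) λ w → Supported L w × Dual w t
weights L t<size =
  let supported , dual =
        lagrange-weights (L zero) (L (suc zero)) (L (suc (suc zero))) (subst (_ <_) (size-tri L) t<size)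
  in _ , (λ x w≢0 → trans (sym (tri-η L x)) (supported x w≢0)) , dual

-- Partial matchings of F₃

ConstantOn : (F₃ → F₃ → Bool) → (F₃ → F₃ → F₃) → Set
ConstantOn R g = ∀ {q r q′ r′} → R q r ≡ true → R q′ r′ ≡ true → g q r ≡ g q′ r′

ConstantOn-cong : ∀ {R g h} → (∀ q r → g q r ≡ h q r) → ConstantOn R g → ConstantOn R h
ConstantOn-cong g≗h const {q} {r} {q′} {r′} Rqr Rq′r′ =
  trans (sym (g≗h q r)) (trans (const Rqr Rq′r′) (g≗h q′ r′))

valueOn : (F₃ → F₃ → Bool) → (F₃ → F₃ → F₃) → F₃
valueOn R g with any? (λ x → any? λ y → R x y Bool.≟ true)
... | yes (x , y , _) = g x y
... | no _ = zero

valueOn-spec : ∀ {R g} → ConstantOn R g → ∀ {q r} → R q r ≡ true → g q r ≡ valueOn R g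
valueOn-spec {R} {g} const {q} {r} Rqr with any? (λ x → any? λ y → R x y Bool.≟ true)
... | yes (x , y , Rxy) = const Rqr Rxy
... | no none = ⊥-elim (none (q , r , Rqr))

agree : (F₃ → F₃ → Bool) → F₃ → F₃ → F₃ → F₃ → Bool
agree R q q′ r r′ = not (R q r ∧ R q′ r′) ∨ ⌊ (q -₃ r) ≟F (q′ -₃ r′) ⌋

agree₃ : (F₃ → F₃ → Bool) → F₃ → F₃ → F₃ → List Bool
agree₃ R q q′ r = map (agree R q q′ r) (allFin 3)

agree₂ : (F₃ → F₃ → Bool) → F₃ → F₃ → List Bool
agree₂ R q q′ = concatMap (agree₃ R q q′) (allFin 3)

agree₁ : (F₃ → F₃ → Bool) → F₃ → List Bool
agree₁ R q = concatMap (agree₂ R q) (allFin 3)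

-- isGood 𝓗 i j unfolds to isGoodRelation (σ 𝓗 i j).
isGoodRelation : (F₃ → F₃ → Bool) → Bool
isGoodRelation R = and (concatMap (agree₁ R) (allFin 3))

isGoodRelation-sound : ∀ R → isGoodRelation R ≡ true → ConstantOn R _-₃_
isGoodRelation-sound R good {q} {r} {q′} {r′} =
  implication-true ((q -₃ r) ≟F (q′ -₃ r′))
    (All-map-allFin⁻ (agree R q q′ r) (All-concatMap-allFin⁻ (agree₃ R q q′)
      (All-concatMap-allFin⁻ (agree₂ R q) (All-concatMap-allFin⁻ (agree₁ R) (and-true good) q) q′) r) r′)

isGoodRelation-complete : ∀ R → ConstantOn R _-₃_ → isGoodRelation R ≡ true
isGoodRelation-complete R const =
  all-true (All-concatMap-allFin⁺ (agree₁ R) λ q → All-concatMap-allFin⁺ (agree₂ R q) λ q′ →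
            All-concatMap-allFin⁺ (agree₃ R q q′) λ r → All-map-allFin⁺ (agree R q q′ r) λ r′ →
            true-implication (R q r) (R q′ r′) ((q -₃ r) ≟F (q′ -₃ r′)) const)

record Matching (R : F₃ → F₃ → Bool) : Set where
  field
    functional : ∀ {q r r′} → R q r ≡ true → R q r′ ≡ true → r ≡ r′
    injective  : ∀ {q q′ r} → R q r ≡ true → R q′ r ≡ true → q ≡ q′

-- In F₃ two distinct nonzero elements are negatives of each other; apply this to q − q′ and r − r′.
sums-agree-if-differences-differ : ∀ q r q′ r′ → (q ≡ q′ → r ≡ r′) → (r ≡ r′ → q ≡ q′) →
                                   q -₃ r ≢ q′ -₃ r′ → q +₃ r ≡ q′ +₃ r′
sums-agree-if-differences-differ = decide₄ λ q r q′ r′ →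
  (q ≟F q′ →-dec r ≟F r′) →-dec (r ≟F r′ →-dec q ≟F q′) →-dec
  ¬? ((q -₃ r) ≟F (q′ -₃ r′)) →-dec (q +₃ r) ≟F (q′ +₃ r′)

module _ {R : F₃ → F₃ → Bool} (M : Matching R) where
  open Matching M

  matching-sums-agree : ∀ {q r q′ r′} → R q r ≡ true → R q′ r′ ≡ true →
                        q -₃ r ≢ q′ -₃ r′ → q +₃ r ≡ q′ +₃ r′
  matching-sums-agree {q} {r} {q′} {r′} Rqr Rq′r′ =
    sums-agree-if-differences-differ q r q′ r′
      (λ q≡q′ → functional Rqr (subst (λ x → R x r′ ≡ true) (sym q≡q′) Rq′r′))
      (λ r≡r′ → injective Rqr (subst (λ y → R q′ y ≡ true) (sym r≡r′) Rq′r′))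

  constant-sum : ¬ ConstantOn R _-₃_ → ConstantOn R _+₃_
  constant-sum ¬const {q} {r} {q′} {r′} Rqr Rq′r′ =
    decidable-stable ((q +₃ r) ≟F (q′ +₃ r′)) λ sums≢ →
      ¬const (λ Rxy Rx′y′ → trans (to-first sums≢ Rxy) (sym (to-first sums≢ Rx′y′)))
    where
    differences≡ : q +₃ r ≢ q′ +₃ r′ → q -₃ r ≡ q′ -₃ r′
    differences≡ sums≢ =
      decidable-stable ((q -₃ r) ≟F (q′ -₃ r′)) λ diffs≢ → sums≢ (matching-sums-agree Rqr Rq′r′ diffs≢)
    to-first : q +₃ r ≢ q′ +₃ r′ → ∀ {x y} → R x y ≡ true → x -₃ y ≡ q -₃ r
    to-first sums≢ {x} {y} Rxy = decidable-stable ((x -₃ y) ≟F (q -₃ r)) λ diff≢ →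
      sums≢ (trans (sym (matching-sums-agree Rxy Rqr diff≢))
                   (matching-sums-agree Rxy Rq′r′ (λ e → diff≢ (trans e (sym (differences≡ sums≢))))))

  matching-line : ConstantOn R (λ q r → q +₃ ((if isGoodRelation R then minusOne₃ else one₃) *₃ r))
  matching-line with isGoodRelation R in good
  ... | true = ConstantOn-cong {R} {_-₃_} (decide₂ λ q r → (q -₃ r) ≟F (q +₃ (minusOne₃ *₃ r)))
                 (isGoodRelation-sound R good)
  ... | false = ConstantOn-cong {R} {_+₃_} (decide₂ λ q r → (q +₃ r) ≟F (q +₃ (one₃ *₃ r)))
                  (constant-sum λ const → true≢false (trans (sym (isGoodRelation-complete R const)) good))

module _ {n : ℕ} {G : Graph n} (𝓗 : PrimeCover3 G) where
  open Graph G
  open PrimeCover3 𝓗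

  σ : Fin n → Fin n → F₃ → F₃ → Bool
  σ i j q r = hadj (i , q) (j , r)

  σ-matching : ∀ {i j} → i ≢ j → Matching (σ i j)
  σ-matching {i} {j} i≢j = record
    { functional = λ {q} {r} {r′} → matching i q j r r′ i≢j
    ; injective  = λ {q} {q′} {r} Rqr Rq′r →
        matching j r i q q′ (i≢j ∘ sym) (trans (hsymm (j , r) (i , q)) Rqr) (trans (hsymm (j , r) (i , q′)) Rq′r)
    }

  offset : Fin n → Fin n → F₃
  offset i j = valueOn (σ i j) (λ q r → q +₃ (B 𝓗 i j *₃ r))

  edge-on-line : ∀ {i j q r} → i ≢ j → σ i j q r ≡ true → q +₃ (B 𝓗 i j *₃ r) ≡ offset i j
  edge-on-line i≢j = valueOn-spec (matching-line (σ-matching i≢j))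

  linear : Fin n × Fin n → Poly n
  linear (i , j) = (one₃ , var i) ∷ (B 𝓗 i j , var j) ∷ []

  shifted : Fin n × Fin n → Poly n
  shifted (i , j) = (one₃ , var i) ∷ (B 𝓗 i j , var j) ∷ (-₃ offset i j , replicate n 0) ∷ []

  linear-homogeneous : ∀ e → Homogeneous 1 (linear e)
  linear-homogeneous (i , j) = deg-var i ∷ deg-var j ∷ []

  shifted-AtMost : ∀ e → AtMost 1 (shifted e)
  shifted-AtMost (i , j) =
    ℕ.≤-reflexive (deg-var i) ∷ ℕ.≤-reflexive (deg-var j) ∷ subst (_≤ 1) (sym (deg-replicate-0 n)) z≤n ∷ []

  shifted-part : ∀ e → part 1 (shifted e) ≡ linear e
  shifted-part (i , j) =
    trans (part-accept one₃ (var i) (bj ∷ constant) (deg-var i)) (cong ((one₃ , var i) ∷_)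
      (trans (part-accept (B 𝓗 i j) (var j) constant (deg-var j)) (cong (bj ∷_)
        (part-reject (-₃ offset i j) (replicate n 0) [] λ deg≡1 → ℕ.0≢1+n (trans (sym (deg-replicate-0 n)) deg≡1)))))
    where
    bj : F₃ × Mono n
    bj = (B 𝓗 i j , var j)
    constant : Poly n
    constant = (-₃ offset i j , replicate n 0) ∷ []

  shifted-vanishes : ∀ {i j} a → i ≢ j → σ i j (lookup a i) (lookup a j) ≡ true → eval (shifted (i , j)) a ≡ zero
  shifted-vanishes {i} {j} a i≢j edge = begin
    eval (shifted (i , j)) a
      ≡⟨ cong₂ (λ x y → value x y (evalMono (replicate n 0) a)) (evalMono-var i a) (evalMono-var j a) ⟩
    value (lookup a i) (lookup a j) (evalMono (replicate n 0) a)
      ≡⟨ cong (value (lookup a i) (lookup a j)) (evalMono-replicate-0 a) ⟩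
    value (lookup a i) (lookup a j) one₃
      ≡⟨ root (lookup a i) (lookup a j) (B 𝓗 i j) (offset i j) (edge-on-line i≢j edge) ⟩
    zero ∎
    where
    open ≡-Reasoning
    value : F₃ → F₃ → F₃ → F₃
    value x y z = (one₃ *₃ x) +₃ ((B 𝓗 i j *₃ y) +₃ (((-₃ offset i j) *₃ z) +₃ zero))
    root : ∀ x y b c → x +₃ (b *₃ y) ≡ c → (one₃ *₃ x) +₃ ((b *₃ y) +₃ (((-₃ c) *₃ one₃) +₃ zero)) ≡ zero
    root = decide₄ λ x y b c →
      (x +₃ (b *₃ y)) ≟F c →-dec ((one₃ *₃ x) +₃ ((b *₃ y) +₃ (((-₃ c) *₃ one₃) +₃ zero))) ≟F zero

  isEdge : Fin n → Fin n → Bool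
  isEdge i j = ⌊ toℕ i ℕ.<? toℕ j ⌋ ∧ adj i j

  edges : List (Fin n × Fin n)
  edges = concatMap (λ i → concatMap (λ j → if isEdge i j then (i , j) ∷ [] else []) (allFin n)) (allFin n)

  fPoly-edges : fPoly 𝓗 ≡ ∏ (map linear edges)
  fPoly-edges = cong ∏ (sym (trans (map-concatMap linear row (allFin n)) (concatMap-cong inner (allFin n))))
    where
    row : Fin n → List (Fin n × Fin n)
    row i = concatMap (λ j → if isEdge i j then (i , j) ∷ [] else []) (allFin n)
    inner : ∀ i → map linear (row i) ≡ concatMap (λ j → if isEdge i j then linear (i , j) ∷ [] else []) (allFin n)
    inner i = trans (map-concatMap linear _ (allFin n)) (concatMap-cong (λ j → map-if linear (isEdge i j) (i , j)) (allFin n))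

  All-edges : ∀ {P : Fin n × Fin n → Set} → All P edges → ∀ {i j} → toℕ i < toℕ j → adj i j ≡ true → P (i , j)
  All-edges all {i} {j} i<j ij =
    All-if (All-concatMap-allFin⁻ _ (All-concatMap-allFin⁻ _ all i) j)
           (trans (cong (_∧ adj i j) (Equivalence.to T-≡ (fromWitness i<j))) ij)

  no-upward-edge : ∀ a → eval (∏ (map shifted edges)) a ≢ zero →
                   ∀ {u v} → toℕ u < toℕ v → hadj (u , lookup a u) (v , lookup a v) ≢ true
  no-upward-edge a nonzero {u} {v} u<v edge =
    All-edges (All.map⁻ (eval-∏-nonzero (map shifted edges) a nonzero)) u<v (cross u _ v _ u≢v edge)
              (shifted-vanishes a u≢v edge)
    where
    u≢v : u ≢ v
    u≢v u≡v = ℕ.<-irrefl (cong toℕ u≡v) u<v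

  independent : ∀ a → eval (∏ (map shifted edges)) a ≢ zero → ∀ u v → hadj (u , lookup a u) (v , lookup a v) ≡ false
  independent a nonzero u v with hadj (u , lookup a u) (v , lookup a v) in edge
  ... | false = refl
  ... | true with ℕ.<-cmp (toℕ u) (toℕ v)
  ...   | tri< u<v _ _ = ⊥-elim (no-upward-edge a nonzero u<v edge)
  ...   | tri> _ _ v<u = ⊥-elim (no-upward-edge a nonzero v<u (trans (hsymm (v , lookup a v) (u , lookup a u)) edge))
  ...   | tri≈ _ u≡v _ = ⊥-elim (no-loop (toℕ-injective u≡v) edge)
    where
    no-loop : u ≡ v → hadj (u , lookup a u) (v , lookup a v) ≢ true
    no-loop refl loop = true≢false (trans (sym loop) (hirrefl (u , lookup a u)))

  nonvanishing-point : (t : Vec ℕ n) → coeff t (fPoly 𝓗) ≢ zero → (∀ i → lookup t i < listSize 𝓗 i) →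
                       ∃ λ a → (∀ i → L i (lookup a i) ≡ true) × eval (∏ (map shifted edges)) a ≢ zero
  nonvanishing-point t coeff≢0 t<size =
    a , (λ i → supported i (lookup a i) (weight-nonzero ws a W≢0 i)) , f′≢0
    where
    ws : Fin n → F₃ → F₃
    ws i = proj₁ (weights (L i) (t<size i))
    supported : ∀ i → Supported (L i) (ws i)
    supported i = proj₁ (proj₂ (weights (L i) (t<size i)))
    dual : ∀ i → Dual (ws i) (lookup t i)
    dual i = proj₂ (proj₂ (weights (L i) (t<size i)))
    f f′ : Poly n
    f = ∏ (map linear edges)
    f′ = ∏ (map shifted edges)
    coeff-f≢0 : coeff t f ≢ zero
    coeff-f≢0 = subst (λ g → coeff t g ≢ zero) fPoly-edges coeff≢0
    deg-t : deg t ≡ length edges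
    deg-t = decidable-stable (deg t ℕ.≟ length edges) λ deg≢ →
      coeff-f≢0 (coeff-homogeneous t (Homogeneous-∏ linear linear-homogeneous edges) deg≢)
    f′-AtMost : AtMost (deg t) f′
    f′-AtMost = subst (λ D → AtMost D f′) (sym deg-t) (AtMost-∏ shifted shifted-AtMost edges)
    weighted-sum : Σⁿ n (λ a → weight ws a *₃ eval f′ a) ≡ coeff t f
    weighted-sum = begin
      Σⁿ n (λ a → weight ws a *₃ eval f′ a)
        ≡⟨ coefficient-formula ws t dual f′ f′-AtMost ⟩
      coeff t f′                        ≡⟨ coeff-part t f′ ⟩
      coeff t (part (deg t) f′)         ≡⟨ cong (λ D → coeff t (part D f′)) deg-t ⟩
      coeff t (part (length edges) f′)  ≡⟨ cong (coeff t) (part-∏ linear shifted shifted-AtMost shifted-part edges) ⟩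
      coeff t f ∎
      where open ≡-Reasoning
    point : ∃ λ a → weight ws a *₃ eval f′ a ≢ zero
    point = Σⁿ-nonzero n (λ a → weight ws a *₃ eval f′ a) (λ sum≡0 → coeff-f≢0 (trans (sym weighted-sum) sum≡0))
    a : Vec F₃ n
    a = proj₁ point
    W≢0 : weight ws a ≢ zero
    W≢0 = proj₁ (*₃-nonzero (weight ws a) (eval f′ a) (proj₂ point))
    f′≢0 : eval f′ a ≢ zero
    f′≢0 = proj₂ (*₃-nonzero (weight ws a) (eval f′ a) (proj₂ point))

  coloring-of : (a : Vec F₃ n) → (∀ i → L i (lookup a i) ≡ true) →
                (∀ u v → hadj (u , lookup a u) (v , lookup a v) ≡ false) → Coloring 𝓗
  coloring-of a a∈L no-edge = record
    { S = chosen
    ; inV = λ u x chosen-x → subst (λ y → L u y ≡ true) (sym (chosen-at chosen-x)) (a∈L u)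
    ; indep = λ { (u , x) (v , y) chosen-x chosen-y →
        subst₂ (λ x y → hadj (u , x) (v , y) ≡ false) (sym (chosen-at chosen-x)) (sym (chosen-at chosen-y))
               (no-edge u v) }
    ; size = trans (sum-ones (allFin n) λ u → one-chosen (lookup a u)) (length-tabulate id)
    }
    where
    chosen : Name n → Bool
    chosen (u , x) = ⌊ x ≟F lookup a u ⌋
    chosen-at : ∀ {u x} → chosen (u , x) ≡ true → x ≡ lookup a u
    chosen-at = toWitness ∘ Equivalence.from T-≡
    one-chosen : ∀ y → length (filter (λ x → ⌊ x ≟F y ⌋ Bool.≟ true) (allFin 3)) ≡ 1
    one-chosen zero = refl
    one-chosen (suc zero) = refl
    one-chosen (suc (suc zero)) = refl
    sum-ones : ∀ {A : Set} {f : A → ℕ} xs → (∀ x → f x ≡ 1) → foldr _+_ 0 (map f xs) ≡ length xs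
    sum-ones [] _ = refl
    sum-ones (x ∷ xs) f≡1 = cong₂ _+_ (f≡1 x) (sum-ones xs f≡1)

theorem3p2 : (n : ℕ) (G : Graph n) (𝓗 : PrimeCover3 G) (t : Vec ℕ n) →
             coeff t (fPoly 𝓗) ≢ zero →
             (∀ i → lookup t i < listSize 𝓗 i) →
             Coloring 𝓗
theorem3p2 n G 𝓗 t coeff≢0 t<size =
  let a , a∈L , nonzero = nonvanishing-point 𝓗 t coeff≢0 t<size
  in coloring-of 𝓗 a a∈L (independent 𝓗 a nonzero)
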